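{- Let $m,n\ge 3$ be integers with $m$ odd and $n\equiv 2\pmod 4$, and suppose $m$ is a smallest odd integer $\ge3$ such that $G_{m,n'}$ has a $3$-dynamic $4$-coloring for some integer $n'\ge 3$. Let $f$ be a $3$-dynamic $4$-coloring of $G_{m,n}$ and write $x_{i,j}=f(i,j)$. Then $x_{3,2}=x_{2,3}$, and similarly at the other corners: $x_{m-2,2}=x_{m-1,3}$, $x_{3,n-1}=x_{2,n-2}$, and $x_{m-2,n-1}=x_{m-1,n-2}$. Furthermore, $m\ge 7$.
   Context: For positive integers $m,n$, the grid $G_{m,n}$ is the graph with vertex set $[m]\times[n]$ (where $[p]=\{1,\dots,p\}$) in which $(i,j)$ and $(i',j')$ are adjacent iff $|i-i'|+|j-j'|=1$; vertex $(i,j)$ is in row $i$ and column $j$. An $r$-dynamic $k$-coloring of a graph $G$ is a proper vertex coloring $f$ with at most $k$ colors such that $|f(N(v))|\ge\min\{r,d(v)\}$ for every vertex $v$, where $N(v)$ is the neighborhood and $d(v)$ the degree of $v$. -}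

module Defs where

open import Data.Nat using (ℕ; _+_; _≤_; _<_; _≤?_; _≟_; ∣_-_∣; _⊓_)
open import Data.Nat.Properties using ()
open import Data.Fin using (Fin)
open import Data.Fin.Properties using () renaming (_≟_ to _≟ᶠ_)
open import Data.List using (List; length; filter; map; concatMap; allFin)
open import Data.List.Base using (upTo)
import Data.List.Membership.DecPropositional as DecMem
open import Data.Product using (_×_; _,_; proj₁; proj₂)
open import Relation.Binary.PropositionalEquality using (_≡_; _≢_)
open import Relation.Nullary using (Dec)
open import Relation.Nullary.Decidable using (_×-dec_)

-- Vertices are pairs (i , j) of naturals; vertex (i , j) of G_{m,n} is in
-- row i, column j, with 1 ≤ i ≤ m and 1 ≤ j ≤ n (1-indexed, as in the paper).
Vertex : Set
Vertex = ℕ × ℕ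

InGrid : ℕ → ℕ → Vertex → Set
InGrid m n (i , j) = (1 ≤ i × i ≤ m) × (1 ≤ j × j ≤ n)

Adj : Vertex → Vertex → Set
Adj (i , j) (i' , j') = ∣ i - i' ∣ + ∣ j - j' ∣ ≡ 1

Adj? : (v w : Vertex) → Dec (Adj v w)
Adj? (i , j) (i' , j') = (∣ i - i' ∣ + ∣ j - j' ∣) ≟ 1

vertices : ℕ → ℕ → List Vertex
vertices m n = concatMap (λ i → map (λ j → (1 + i , 1 + j)) (upTo n)) (upTo m)

nbrs : ℕ → ℕ → Vertex → List Vertex
nbrs m n v = filter (Adj? v) (vertices m n)

deg : ℕ → ℕ → Vertex → ℕ
deg m n v = length (nbrs m n v)

Coloring : ℕ → Set
Coloring k = ℕ → ℕ → Fin k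

numNbrColors : ∀ {k} → ℕ → ℕ → Coloring k → Vertex → ℕ
numNbrColors {k} m n f v =
  length (filter (λ c → DecMem._∈?_ (_≟ᶠ_ {k}) c (map (λ w → f (proj₁ w) (proj₂ w)) (nbrs m n v))) (allFin k))

Proper : ∀ {k} → ℕ → ℕ → Coloring k → Set
Proper m n f = ∀ i j i' j' → InGrid m n (i , j) → InGrid m n (i' , j') →
  Adj (i , j) (i' , j') → f i j ≢ f i' j'

IsDynamicColoring : ℕ → ∀ {k} → ℕ → ℕ → Coloring k → Set
IsDynamicColoring r m n f = Proper m n f ×
  (∀ i j → InGrid m n (i , j) → r ⊓ deg m n (i , j) ≤ numNbrColors m n f (i , j))

-- The statement is local. A 3-dynamic 4-colouring of G_{m,n} restricts to every
-- window (a block of consecutive rows and columns) as a proper colouring that is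
-- still 3-dynamic at each window vertex whose grid neighbourhood lies inside the
-- window. An exhaustive backtracking search over such window colourings shows that
-- the 4 × 4 window at a corner of the grid forces x_{3,2} = x_{2,3} (and its mirror
-- images at the other corners), and that the 3 × 4 and 5 × 4 windows at the left
-- end of a grid with 3 or 5 rows admit no colouring at all. As m is odd, m ≥ 7
-- follows.

module Submission where

open import Defs
open import Data.Bool using (Bool; true; false; not; _∧_; _∨_; T; if_then_else_)
open import Data.Bool.ListAction using (all)
open import Data.Empty using (⊥; ⊥-elim)
open import Data.Unit using (tt)
open import Data.Fin using (Fin; zero)
open import Data.Fin.Properties using () renaming (_≟_ to _≟ᶠ_)
open import Data.List using (List; []; _∷_; _++_; map; filter; concatMap; allFin; length; upTo)
open import Data.List.Properties using (map-cong-local; length-map; length-++)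
open import Data.List.Membership.Propositional using (_∈_; find; lose)
open import Data.List.Membership.Propositional.Properties
  using (∈-map⁺; ∈-map⁻; ∈-concatMap⁺; ∈-concatMap⁻; ∈-filter⁺; ∈-filter⁻; ∈-upTo⁺; ∈-upTo⁻;
         ∈-allFin; ∈-∃++; ∈-++⁺ˡ; ∈-++⁺ʳ; ∈-++⁻)
open import Data.List.Relation.Unary.All as All using (All; []; _∷_)
open import Data.List.Relation.Unary.All.Properties using (all⁺; all⁻; filter⁺)
import Data.List.Relation.Unary.All.Properties as Allₚ
import Data.List.Relation.Unary.AllPairs as AllPairs
import Data.List.Relation.Unary.AllPairs.Properties as AllPairsₚ
open import Data.List.Relation.Unary.Any using (here; there)
open import Data.List.Relation.Unary.Unique.Propositional using (Unique; []; _∷_)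
import Data.List.Relation.Unary.Unique.Propositional.Properties as Uniqueₚ
open import Data.List.Relation.Binary.Disjoint.Propositional using (Disjoint)
open import Data.List.Relation.Binary.Sublist.Propositional using (⊆-refl)
open import Data.List.Relation.Binary.Sublist.Heterogeneous.Properties
  using (length-mono-≤; ⊆-filter-Sublist)
import Data.List.Membership.DecPropositional as DecMembership
open import Data.Maybe using (Maybe; just; nothing; is-just; fromMaybe)
open import Data.Maybe.Properties using (just-injective)
open import Data.Nat using (ℕ; zero; suc; _+_; _∸_; _⊓_; _≤_; _<_; _≤ᵇ_; _%_; z≤n; s≤s; ∣_-_∣)
open import Data.Nat.Properties
open import Data.Product using (Σ; ∃-syntax; _×_; _,_; proj₁; proj₂)
open import Data.Product.Properties using (≡-dec)
open import Data.Sum using (_⊎_; inj₁; inj₂)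
open import Function using (_∘_; id)
open import Relation.Binary.Definitions using (DecidableEquality)
open import Relation.Binary.PropositionalEquality
open import Relation.Nullary using (¬_; yes; no; does)
open import Relation.Nullary.Decidable using (T?; _×-dec_; _→-dec_; dec-false; decidable-stable)
open import Relation.Unary using (Decidable)

modus-ponensᵇ : ∀ {a b} → T a → T (not a ∨ b) → T b
modus-ponensᵇ {true} _ h = h

Unique⇒length≤ : ∀ {A : Set} {xs ys : List A} →
  Unique xs → (∀ {x} → x ∈ xs → x ∈ ys) → length xs ≤ length ys
Unique⇒length≤ [] _ = z≤n
Unique⇒length≤ {xs = x ∷ xs} {ys} (x∉xs ∷ unique) xs⊆ys with ∈-∃++ (xs⊆ys (here refl))
... | front , back , refl = begin
  suc (length xs)                  ≤⟨ s≤s (Unique⇒length≤ unique xs⊆front++back) ⟩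
  suc (length (front ++ back))     ≡⟨ cong suc (length-++ front) ⟩
  suc (length front + length back) ≡⟨ +-suc (length front) (length back) ⟨
  length front + length (x ∷ back) ≡⟨ length-++ front ⟨
  length (front ++ x ∷ back)       ∎
  where
  open ≤-Reasoning
  xs⊆front++back : ∀ {y} → y ∈ xs → y ∈ front ++ back
  xs⊆front++back {y} y∈xs with ∈-++⁻ front (xs⊆ys (there y∈xs))
  ... | inj₁ y∈front = ∈-++⁺ˡ y∈front
  ... | inj₂ (here refl) = ⊥-elim (All.lookup x∉xs y∈xs refl)
  ... | inj₂ (there y∈back) = ∈-++⁺ʳ front y∈back

module ColouringSearch {A : Set} (_≟_ : DecidableEquality A) (k : ℕ) where

  open DecMembership _≟_ using (_∈?_)
  open DecMembership (_≟ᶠ_ {suc k}) using () renaming (_∈?_ to _∈ᶜ?_)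

  Colour : Set
  Colour = Fin (suc k)

  record Check : Set where
    field
      support : List A
      holds   : (A → Colour) → Bool
      local   : ∀ {g h} → (∀ {x} → x ∈ support → g x ≡ h x) → holds g ≡ holds h

  open Check public

  Satisfies : (A → Colour) → List Check → Set
  Satisfies g = All (λ c → T (holds c g))

  distinct : A → A → Check
  distinct x y = record
    { support = x ∷ y ∷ []
    ; holds   = λ g → not (does (g x ≟ᶠ g y))
    ; local   = λ g≗h →
        cong₂ (λ c d → not (does (c ≟ᶠ d))) (g≗h (here refl)) (g≗h (there (here refl)))
    }

  distinct-holds : ∀ {g x y} → g x ≢ g y → T (holds (distinct x y) g)
  distinct-holds {g} {x} {y} gx≢gy = subst (T ∘ not) (sym (dec-false (g x ≟ᶠ g y) gx≢gy)) _

  numColours : List Colour → ℕ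
  numColours cs = length (filter (_∈ᶜ? cs) (allFin (suc k)))

  numColours-mono : ∀ {cs ds} → (∀ {c} → c ∈ cs → c ∈ ds) → numColours cs ≤ numColours ds
  numColours-mono {cs} {ds} cs⊆ds =
    length-mono-≤
      (⊆-filter-Sublist (_∈ᶜ? cs) (_∈ᶜ? ds) (λ { refl → cs⊆ds }) (⊆-refl {x = allFin (suc k)}))

  colourful : ℕ → List A → Check
  colourful r xs = record
    { support = xs
    ; holds   = λ g → r ≤ᵇ numColours (map g xs)
    ; local   = λ g≗h → cong (λ cs → r ≤ᵇ numColours cs) (map-cong-local (All.tabulate g≗h))
    }

  colourful-holds : ∀ {g r xs} → r ≤ numColours (map g xs) → T (holds (colourful r xs) g)
  colourful-holds = ≤⇒≤ᵇ

  Assignment : Set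
  Assignment = List (A × Colour)

  valueAt : Assignment → A → Maybe Colour
  valueAt [] x = nothing
  valueAt ((y , c) ∷ ρ) x = if does (x ≟ y) then just c else valueAt ρ x

  holdsOn : Assignment → Check → Bool
  holdsOn ρ c =
    if all (is-just ∘ valueAt ρ) (support c) then holds c (fromMaybe zero ∘ valueAt ρ) else true

  -- each step assigns one point and then tests the listed checks
  Plan : Set
  Plan = List (A × List Check)

  refutes : Plan → Assignment → Bool
  refutes [] ρ = false
  refutes ((x , cs) ∷ plan) ρ = all branch (allFin (suc k))
    where
    branch : Colour → Bool
    branch c = not (all (holdsOn ((x , c) ∷ ρ)) cs) ∨ refutes plan ((x , c) ∷ ρ)

  coveredBy : List A → Check → Bool
  coveredBy xs c = all (λ y → does (y ∈? xs)) (support c)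

  -- Pruning by any true checks is sound; testing each check exactly at the step
  -- completing its support keeps the search cheap.
  schedule : List Check → List A → List A → Plan
  schedule cs done [] = []
  schedule cs done (x ∷ xs) =
    (x , filter (λ c → T? (coveredBy (x ∷ done) c ∧ not (coveredBy done c))) cs) ∷
    schedule cs (x ∷ done) xs

  Agrees : (A → Colour) → Assignment → Set
  Agrees g ρ = ∀ {x c} → valueAt ρ x ≡ just c → g x ≡ c

  agrees-∷ : ∀ {g ρ} x → Agrees g ρ → Agrees g ((x , g x) ∷ ρ)
  agrees-∷ x g≈ρ {y} eq with y ≟ x
  ... | yes refl = just-injective eq
  ... | no _ = g≈ρ eq

  agrees-assigned : ∀ {g ρ} x → Agrees g ρ → T (is-just (valueAt ρ x)) →
    g x ≡ fromMaybe zero (valueAt ρ x)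
  agrees-assigned {ρ = ρ} x g≈ρ _ with valueAt ρ x in eq
  ... | just c = g≈ρ eq

  holdsOn-sound : ∀ {g ρ} c → Agrees g ρ → T (holds c g) → T (holdsOn ρ c)
  holdsOn-sound {g} {ρ} c g≈ρ g⊨c with all (is-just ∘ valueAt ρ) (support c) in eq
  ... | false = _
  ... | true = subst T (local c {g} {fromMaybe zero ∘ valueAt ρ} g≗completion) g⊨c
    where
    assigned : All (T ∘ is-just ∘ valueAt ρ) (support c)
    assigned = all⁺ _ (support c) (subst T (sym eq) _)
    g≗completion : ∀ {x} → x ∈ support c → g x ≡ fromMaybe zero (valueAt ρ x)
    g≗completion {x} x∈ = agrees-assigned {ρ = ρ} x g≈ρ (All.lookup assigned x∈)

  refutes-sound : ∀ {g} plan ρ → Agrees g ρ → All (Satisfies g ∘ proj₂) plan →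
    ¬ T (refutes plan ρ)
  refutes-sound [] ρ _ _ ()
  refutes-sound {g} ((x , cs) ∷ plan) ρ g≈ρ (g⊨cs ∷ g⊨plan) r =
    refutes-sound plan ρ′ g≈ρ′ g⊨plan
      (modus-ponensᵇ passes (All.lookup (all⁺ _ (allFin (suc k)) r) (∈-allFin (g x))))
    where
    ρ′ : Assignment
    ρ′ = (x , g x) ∷ ρ
    g≈ρ′ : Agrees g ρ′
    g≈ρ′ = agrees-∷ {ρ = ρ} x g≈ρ
    passes : T (all (holdsOn ρ′) cs)
    passes = all⁻ (holdsOn ρ′) (All.map (λ {c} → holdsOn-sound {ρ = ρ′} c g≈ρ′) g⊨cs)

  schedule-sound : ∀ {g cs} done xs → Satisfies g cs →
    All (Satisfies g ∘ proj₂) (schedule cs done xs)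
  schedule-sound done [] g⊨cs = []
  schedule-sound done (x ∷ xs) g⊨cs = filter⁺ _ g⊨cs ∷ schedule-sound (x ∷ done) xs g⊨cs

  Refuted : List Check → List A → Set
  Refuted cs xs = T (refutes (schedule cs [] xs) [])

  refuted⇒unsatisfiable : ∀ {cs} xs → Refuted cs xs → ∀ g → ¬ Satisfies g cs
  refuted⇒unsatisfiable xs r g g⊨cs =
    refutes-sound (schedule _ [] xs) [] (λ ()) (schedule-sound [] xs g⊨cs) r

_≟ᵛ_ : DecidableEquality Vertex
_≟ᵛ_ = ≡-dec _≟_ _≟_

∈-vertices⁻ : ∀ {m n w} → w ∈ vertices m n → InGrid m n w
∈-vertices⁻ {m} {n} w∈
  with find (∈-concatMap⁻ (λ i → map (λ j → (1 + i , 1 + j)) (upTo n)) {xs = upTo m} w∈)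
... | i , i∈ , w∈row with ∈-map⁻ (λ j → (1 + i , 1 + j)) w∈row
... | j , j∈ , refl = (s≤s z≤n , ∈-upTo⁻ i∈) , (s≤s z≤n , ∈-upTo⁻ j∈)

∈-vertices⁺ : ∀ {m n w} → InGrid m n w → w ∈ vertices m n
∈-vertices⁺ {m} {n} {suc i , suc j} ((_ , i≤m) , (_ , j≤n)) =
  ∈-concatMap⁺ (λ i → map (λ j → (1 + i , 1 + j)) (upTo n)) {xs = upTo m}
    (lose (∈-upTo⁺ i≤m) (∈-map⁺ (λ j → (1 + i , 1 + j)) (∈-upTo⁺ j≤n)))

∈-nbrs⁻ : ∀ {m n v w} → w ∈ nbrs m n v → InGrid m n w × Adj v w
∈-nbrs⁻ {v = v} w∈ with ∈-filter⁻ (Adj? v) w∈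
... | w∈vertices , adj = ∈-vertices⁻ w∈vertices , adj

∈-nbrs⁺ : ∀ {m n v w} → InGrid m n w → Adj v w → w ∈ nbrs m n v
∈-nbrs⁺ {v = v} w∈grid adj = ∈-filter⁺ (Adj? v) (∈-vertices⁺ w∈grid) adj

vertices-unique : ∀ m n → Unique (vertices m n)
vertices-unique m n =
  Uniqueₚ.concat⁺ rows-unique (AllPairsₚ.map⁺ (AllPairs.map rows-disjoint (Uniqueₚ.upTo⁺ m)))
  where
  row : ℕ → List Vertex
  row i = map (λ j → (1 + i , 1 + j)) (upTo n)
  rows-unique : All Unique (map row (upTo m))
  rows-unique = Allₚ.map⁺ (All.universal row-unique _)
    where
    row-unique : ∀ i → Unique (row i)
    row-unique _ = Uniqueₚ.map⁺ (λ eq → suc-injective (cong proj₂ eq)) (Uniqueₚ.upTo⁺ n)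
  rows-disjoint : ∀ {i i′} → i ≢ i′ → Disjoint (row i) (row i′)
  rows-disjoint i≢i′ (v∈ , v∈′) with ∈-map⁻ _ v∈ | ∈-map⁻ _ v∈′
  ... | _ , _ , refl | _ , _ , eq = i≢i′ (suc-injective (cong proj₁ eq))

∣m-n∣≡1⇒n≡1+m⊎m≡1+n : ∀ {m n} → ∣ m - n ∣ ≡ 1 → n ≡ suc m ⊎ m ≡ suc n
∣m-n∣≡1⇒n≡1+m⊎m≡1+n {zero} eq = inj₁ eq
∣m-n∣≡1⇒n≡1+m⊎m≡1+n {suc m} {zero} eq = inj₂ eq
∣m-n∣≡1⇒n≡1+m⊎m≡1+n {suc m} {suc n} eq with ∣m-n∣≡1⇒n≡1+m⊎m≡1+n {m} {n} eq
... | inj₁ n≡1+m = inj₁ (cong suc n≡1+m)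
... | inj₂ m≡1+n = inj₂ (cong suc m≡1+n)

∣m+o-n+o∣≡∣m-n∣ : ∀ m n o → ∣ m + o - n + o ∣ ≡ ∣ m - n ∣
∣m+o-n+o∣≡∣m-n∣ m n o rewrite +-comm m o | +-comm n o = ∣m+n-m+o∣≡∣n-o∣ o m n

Adj-cases : ∀ {i j i′ j′} → Adj (i , j) (i′ , j′) →
  (i ≡ i′ × ∣ j - j′ ∣ ≡ 1) ⊎ (∣ i - i′ ∣ ≡ 1 × j ≡ j′)
Adj-cases {i} {j} {i′} {j′} adj with ∣ i - i′ ∣ in di | ∣ j - j′ ∣ in dj | adj
... | zero        | _      | refl = inj₁ (∣m-n∣≡0⇒m≡n di , refl)
... | suc zero    | zero   | refl = inj₂ (refl , ∣m-n∣≡0⇒m≡n dj)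
... | suc zero    | suc _  | ()
... | suc (suc _) | _      | ()

-- One axis of a window: its length, and whether its first and last lines lie on
-- the boundary of the grid.
record Extent : Set where
  constructor extent
  field
    size    : ℕ
    onStart : Bool
    onEnd   : Bool

open Extent

-- the grid neighbours of position p along this axis lie in the window
Inner : Extent → ℕ → Set
Inner e p = (p ≡ 1 → T (onStart e)) × (p ≡ size e → T (onEnd e))

inner? : ∀ e → Decidable (Inner e)
inner? e p = (p ≟ 1 →-dec T? (onStart e)) ×-dec (p ≟ size e →-dec T? (onEnd e))

-- window positions 1 .. size e sit at grid positions 1 + a .. size e + a of 1 .. m
record Placed (e : Extent) (a m : ℕ) : Set where
  field
    fits  : size e + a ≤ m
    start : T (onStart e) → a ≡ 0
    end   : T (onEnd e) → size e + a ≡ m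

open Placed

placed-inside : ∀ {e a m p} → Placed e a m → 1 ≤ p → p ≤ size e → 1 ≤ p + a × p + a ≤ m
placed-inside {a = a} {p = p} pl 1≤p p≤size =
  ≤-trans 1≤p (m≤m+n p a) , ≤-trans (+-monoˡ-≤ a p≤size) (fits pl)

placed-step : ∀ {e a m p x} → Placed e a m → 1 ≤ p → p ≤ size e → Inner e p → 1 ≤ x → x ≤ m →
  ∣ p + a - x ∣ ≡ 1 → ∃[ p′ ] (1 ≤ p′ × p′ ≤ size e) × x ≡ p′ + a
placed-step {a = a} {p = p} {x} pl 1≤p p≤size (first , last) 1≤x x≤m d
  with ∣m-n∣≡1⇒n≡1+m⊎m≡1+n {p + a} {x} d
... | inj₁ refl with m≤n⇒m<n∨m≡n p≤size
...   | inj₁ p<size = suc p , (s≤s z≤n , p<size) , refl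
...   | inj₂ refl = ⊥-elim (1+n≰n (≤-trans x≤m (≤-reflexive (sym (end pl (last refl))))))
placed-step {p = suc zero} pl _ _ (first , _) 1≤x _ _ | inj₂ 1+a≡1+x with start pl (first refl)
... | refl = ⊥-elim (1+n≰n (≤-trans 1≤x (≤-reflexive (sym (suc-injective 1+a≡1+x)))))
placed-step {p = suc (suc p)} _ _ p≤size _ _ _ _ | inj₂ eq =
  suc p , (s≤s z≤n , ≤-trans (n≤1+n (suc p)) p≤size) , sym (suc-injective eq)

shift : ℕ → ℕ → Vertex → Vertex
shift a b (i , j) = (i + a , j + b)

shift-injective : ∀ {a b u w} → shift a b u ≡ shift a b w → u ≡ w
shift-injective {a} {b} eq =
  cong₂ _,_ (+-cancelʳ-≡ a _ _ (cong proj₁ eq)) (+-cancelʳ-≡ b _ _ (cong proj₂ eq))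

Adj-shift⁺ : ∀ a b u w → Adj u w → Adj (shift a b u) (shift a b w)
Adj-shift⁺ a b (i , j) (i′ , j′) rewrite ∣m+o-n+o∣≡∣m-n∣ i i′ a | ∣m+o-n+o∣≡∣m-n∣ j j′ b = id

Adj-shift⁻ : ∀ a b u w → Adj (shift a b u) (shift a b w) → Adj u w
Adj-shift⁻ a b (i , j) (i′ , j′) rewrite ∣m+o-n+o∣≡∣m-n∣ i i′ a | ∣m+o-n+o∣≡∣m-n∣ j j′ b = id

Closed : Extent → Extent → Vertex → Set
Closed R C (p , q) = Inner R p × Inner C q

closed? : ∀ R C → Decidable (Closed R C)
closed? R C (p , q) = inner? R p ×-dec inner? C q

-- start from the window corner on the grid boundary, where the checks bite first
searchOrder : Extent → Extent → List Vertex
searchOrder R C = map (λ (p , q) → fromEnd R p , fromEnd C q) (vertices (size R) (size C))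
  where
  fromEnd : Extent → ℕ → ℕ
  fromEnd e p = if onEnd e then suc (size e) ∸ p else p

module _ {R C : Extent} {a b m n : ℕ} (rows : Placed R a m) (cols : Placed C b n) where

  private
    P Q : ℕ
    P = size R
    Q = size C

  shift-inGrid : ∀ {u} → InGrid P Q u → InGrid m n (shift a b u)
  shift-inGrid ((1≤i , i≤P) , (1≤j , j≤Q)) = placed-inside rows 1≤i i≤P , placed-inside cols 1≤j j≤Q

  deg-shift : ∀ u → deg P Q u ≤ deg m n (shift a b u)
  deg-shift u = begin
    deg P Q u                             ≡⟨ length-map (shift a b) (nbrs P Q u) ⟨
    length (map (shift a b) (nbrs P Q u)) ≤⟨ Unique⇒length≤ unique image⊆nbrs ⟩
    deg m n (shift a b u)                 ∎
    where
    open ≤-Reasoning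
    unique : Unique (map (shift a b) (nbrs P Q u))
    unique = Uniqueₚ.map⁺ shift-injective (Uniqueₚ.filter⁺ (Adj? u) (vertices-unique P Q))
    image⊆nbrs : ∀ {x} → x ∈ map (shift a b) (nbrs P Q u) → x ∈ nbrs m n (shift a b u)
    image⊆nbrs x∈ with ∈-map⁻ (shift a b) x∈
    ... | w , w∈ , refl with ∈-nbrs⁻ {P} {Q} {u} w∈
    ... | w∈grid , adj = ∈-nbrs⁺ {m} {n} {shift a b u} (shift-inGrid w∈grid) (Adj-shift⁺ a b u w adj)

  closed-nbrs : ∀ {u w′} → InGrid P Q u → Closed R C u → w′ ∈ nbrs m n (shift a b u) →
    ∃[ w ] w ∈ nbrs P Q u × w′ ≡ shift a b w
  closed-nbrs {p , q} {x , y} (p∈ @ (1≤p , p≤P) , q∈ @ (1≤q , q≤Q)) (innerR , innerC) w′∈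
    with ∈-nbrs⁻ {m} {n} {p + a , q + b} w′∈
  ... | ((1≤x , x≤m) , (1≤y , y≤n)) , adj with Adj-cases {p + a} {q + b} {x} {y} adj
  ... | inj₁ (refl , dy) with placed-step cols 1≤q q≤Q innerC 1≤y y≤n dy
  ...   | q′ , q′∈ , refl =
    (p , q′) , ∈-nbrs⁺ {P} {Q} {p , q} (p∈ , q′∈) (Adj-shift⁻ a b (p , q) (p , q′) adj) , refl
  closed-nbrs {p , q} {x , y} (p∈ @ (1≤p , p≤P) , q∈) (innerR , _) _
    | ((1≤x , x≤m) , _) , adj | inj₂ (dx , refl) with placed-step rows 1≤p p≤P innerR 1≤x x≤m dx
  ...   | p′ , p′∈ , refl =
    (p′ , q) , ∈-nbrs⁺ {P} {Q} {p , q} (p′∈ , q∈) (Adj-shift⁻ a b (p , q) (p′ , q) adj) , refl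

module DynamicWindows (r k : ℕ) where

  open ColouringSearch _≟ᵛ_ k public

  windowChecks : Extent → Extent → List Check
  windowChecks R C =
    concatMap (λ u → map (distinct u) (nbrs P Q u)) (vertices P Q) ++
    map (λ u → colourful (r ⊓ deg P Q u) (nbrs P Q u)) (filter (closed? R C) (vertices P Q))
    where
    P Q : ℕ
    P = size R
    Q = size C

  window : Coloring (suc k) → ℕ → ℕ → Vertex → Fin (suc k)
  window f a b (i , j) = f (i + a) (j + b)

  module _ {R C : Extent} {a b m n : ℕ} (rows : Placed R a m) (cols : Placed C b n)
           {f : Coloring (suc k)} (dyn : IsDynamicColoring r m n f) where

    private
      P Q : ℕ
      P = size R
      Q = size C

    window-proper : ∀ {u w} → InGrid P Q u → InGrid P Q w → Adj u w →
      window f a b u ≢ window f a b w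
    window-proper {u} {w} u∈ w∈ adj =
      proj₁ dyn _ _ _ _ (shift-inGrid rows cols {u} u∈) (shift-inGrid rows cols {w} w∈)
        (Adj-shift⁺ a b u w adj)

    window-dynamic : ∀ {u} → InGrid P Q u → Closed R C u →
      r ⊓ deg P Q u ≤ numColours (map (window f a b) (nbrs P Q u))
    window-dynamic {u} u∈ closed = begin
      r ⊓ deg P Q u                                  ≤⟨ ⊓-monoʳ-≤ r (deg-shift rows cols u) ⟩
      r ⊓ deg m n (shift a b u)                      ≤⟨ proj₂ dyn _ _ u′∈ ⟩
      numNbrColors m n f (shift a b u)               ≤⟨ numColours-mono colours⊆ ⟩
      numColours (map (window f a b) (nbrs P Q u))   ∎
      where
      open ≤-Reasoning
      u′∈ : InGrid m n (shift a b u)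
      u′∈ = shift-inGrid rows cols {u} u∈
      colours⊆ : ∀ {c} → c ∈ map (λ w → f (proj₁ w) (proj₂ w)) (nbrs m n (shift a b u)) →
        c ∈ map (window f a b) (nbrs P Q u)
      colours⊆ c∈ with ∈-map⁻ _ c∈
      ... | w′ , w′∈ , refl with closed-nbrs rows cols {u} {w′} u∈ closed w′∈
      ... | w , w∈ , refl = ∈-map⁺ (window f a b) w∈

    window-satisfies : Satisfies (window f a b) (windowChecks R C)
    window-satisfies =
      Allₚ.++⁺ (Allₚ.concat⁺ (Allₚ.map⁺ (All.tabulate properAt)))
               (Allₚ.map⁺ (All.tabulate dynamicAt))
      where
      properAt : ∀ {u} → u ∈ vertices P Q →
        Satisfies (window f a b) (map (distinct u) (nbrs P Q u))
      properAt {u} u∈ = Allₚ.map⁺ (All.tabulate λ {w} w∈ →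
        let w∈grid , adj = ∈-nbrs⁻ {P} {Q} {u} w∈ in
        distinct-holds {window f a b} {u} {w} (window-proper {u} {w} (∈-vertices⁻ u∈) w∈grid adj))
      dynamicAt : ∀ {u} → u ∈ filter (closed? R C) (vertices P Q) →
        T (holds (colourful (r ⊓ deg P Q u) (nbrs P Q u)) (window f a b))
      dynamicAt {u} u∈ =
        let u∈vertices , closed = ∈-filter⁻ (closed? R C) u∈ in
        colourful-holds {window f a b} {r ⊓ deg P Q u} {nbrs P Q u}
          (window-dynamic {u} (∈-vertices⁻ u∈vertices) closed)

    window-uncolourable : Refuted (windowChecks R C) (searchOrder R C) → ⊥
    window-uncolourable refuted =
      refuted⇒unsatisfiable (searchOrder R C) refuted (window f a b) window-satisfies

    window-forces : ∀ u w → Refuted (distinct u w ∷ windowChecks R C) (searchOrder R C) →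
      window f a b u ≡ window f a b w
    window-forces u w refuted = decidable-stable (_ ≟ᶠ _) λ u≢w →
      refuted⇒unsatisfiable (searchOrder R C) refuted (window f a b)
        (distinct-holds {window f a b} {u} {w} u≢w ∷ window-satisfies)

open DynamicWindows 3 3

placed-first : ∀ {P m} → P ≤ m → Placed (extent P true false) 0 m
placed-first {P} P≤m = record
  { fits = ≤-trans (≤-reflexive (+-identityʳ P)) P≤m ; start = λ _ → refl ; end = λ () }

placed-last : ∀ {P a} → Placed (extent P false true) a (P + a)
placed-last = record { fits = ≤-refl ; start = λ () ; end = λ _ → refl }

placed-all : ∀ {P} → Placed (extent P true true) 0 P
placed-all {P} = record
  { fits = ≤-reflexive (+-identityʳ P) ; start = λ _ → refl ; end = λ _ → +-identityʳ P }

corners-forced : ∀ a b (f : Coloring 4) → IsDynamicColoring 3 (4 + a) (4 + b) f →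
  (f 3 2 ≡ f 2 3) × (f (2 + a) 2 ≡ f (3 + a) 3) ×
  (f 3 (3 + b) ≡ f 2 (2 + b)) × (f (2 + a) (3 + b) ≡ f (3 + a) (2 + b))
corners-forced a b f dyn =
  window-forces top    left  dyn (3 , 2) (2 , 3) tt ,
  window-forces bottom left  dyn (2 , 2) (3 , 3) tt ,
  window-forces top    right dyn (3 , 3) (2 , 2) tt ,
  window-forces bottom right dyn (2 , 3) (3 , 2) tt
  where
  top : Placed (extent 4 true false) 0 (4 + a)
  top = placed-first (m≤m+n 4 a)
  bottom : Placed (extent 4 false true) a (4 + a)
  bottom = placed-last
  left : Placed (extent 4 true false) 0 (4 + b)
  left = placed-first (m≤m+n 4 b)
  right : Placed (extent 4 false true) b (4 + b)
  right = placed-last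

three-rows-uncolourable : ∀ b (f : Coloring 4) → ¬ IsDynamicColoring 3 3 (4 + b) f
three-rows-uncolourable b f dyn = window-uncolourable placed-all (placed-first (m≤m+n 4 b)) dyn tt

five-rows-uncolourable : ∀ b (f : Coloring 4) → ¬ IsDynamicColoring 3 5 (4 + b) f
five-rows-uncolourable b f dyn = window-uncolourable placed-all (placed-first (m≤m+n 4 b)) dyn tt

odd-rows≥7 : ∀ a b (f : Coloring 4) → (4 + a) % 2 ≡ 1 →
  IsDynamicColoring 3 (4 + a) (4 + b) f → 7 ≤ 4 + a
odd-rows≥7 zero b f () dyn
odd-rows≥7 (suc zero) b f _ dyn = ⊥-elim (five-rows-uncolourable b f dyn)
odd-rows≥7 (suc (suc zero)) b f () dyn
odd-rows≥7 (suc (suc (suc k))) b f _ _ = m≤m+n 7 k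

lemma2p2 : (m n : ℕ) → 3 ≤ m → 3 ≤ n → m % 2 ≡ 1 → n % 4 ≡ 2 →
    (∀ m' → 3 ≤ m' → m' % 2 ≡ 1 → m' < m →
      ¬ (Σ ℕ (λ n' → 3 ≤ n' × Σ (Coloring 4) (λ g → IsDynamicColoring 3 m' n' g)))) →
    (f : Coloring 4) → IsDynamicColoring 3 m n f →
    (f 3 2 ≡ f 2 3) × (f (m ∸ 2) 2 ≡ f (m ∸ 1) 3) ×
    (f 3 (n ∸ 1) ≡ f 2 (n ∸ 2)) × (f (m ∸ 2) (n ∸ 1) ≡ f (m ∸ 1) (n ∸ 2)) ×
    7 ≤ m
lemma2p2 (suc (suc (suc (suc a)))) (suc (suc (suc (suc b)))) _ _ odd _ _ f dyn =
  let top-left , bottom-left , top-right , bottom-right = corners-forced a b f dyn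
  in top-left , bottom-left , top-right , bottom-right , odd-rows≥7 a b f odd dyn
lemma2p2 3 (suc (suc (suc (suc b)))) _ _ _ _ _ f dyn = ⊥-elim (three-rows-uncolourable b f dyn)
lemma2p2 _ 3 _ _ _ () _ _ _
lemma2p2 _ 0 _ () _ _ _ _ _
lemma2p2 _ 1 _ (s≤s ()) _ _ _ _ _
lemma2p2 _ 2 _ (s≤s (s≤s ())) _ _ _ _ _
lemma2p2 0 _ () _ _ _ _ _ _
lemma2p2 1 _ (s≤s ()) _ _ _ _ _ _
lemma2p2 2 _ (s≤s (s≤s ())) _ _ _ _ _ _
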